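{- For integers $n, m \geq 0$, let $cp_0(n, m)$ denote the number of partitions of $n$ into $m$ parts $\lambda_1 \leq \cdots \leq \lambda_m$ such that $\lambda_{i+1} - \lambda_i \geq 2$ for all $i$, and $\lambda_{i+1} - \lambda_i \geq 4$ unless $\lambda_i + \lambda_{i+1}$ is a multiple of $3$. Then \[ \sum_{m, n \geq 0} cp_0(n,m) q^n x^m = \sum_{n_1, n_2 \geq 0} \frac{ q^{6n_2^2 + 2n_1^2 + 6n_2 n_1} (1 + xq^{6n_2 + 3n_1 + 1}) x^{2n_2 + n_1} }{ (q; q)_{n_1} (q^3; q^3)_{n_2} }. \]
   Context: A partition of $n$ into $m$ parts is a non-decreasing sequence of $m$ positive integers summing to $n$. For $n \geq 0$, $(a; q)_n = \prod_{j=1}^{n} (1 - a q^{j-1})$, with the empty product equal to $1$. -}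

module Defs where

open import Data.Nat using (ℕ; zero; suc; _+_; _*_; _∸_; _≤_; _≤?_; _≟_)
open import Data.Nat.Divisibility using (_∣_; _∣?_)
open import Data.List using (List; []; _∷_; length; filter; map; concatMap)
open import Data.Nat.ListAction using (sum)
open import Data.List.Relation.Unary.All using (All; all?)
open import Data.Product using (_×_)
open import Data.Sum using (_⊎_)
open import Data.Unit using (⊤; tt)
open import Relation.Nullary using (Dec; yes)
open import Relation.Nullary.Decidable using (_×-dec_; _⊎-dec_)
open import Relation.Binary.PropositionalEquality using (_≡_)

Gap : ℕ → ℕ → Set
Gap a b = (a + 2 ≤ b) × ((3 ∣ a + b) ⊎ (a + 4 ≤ b))

gap? : ∀ a b → Dec (Gap a b)
gap? a b = (a + 2 ≤? b) ×-dec ((3 ∣? a + b) ⊎-dec (a + 4 ≤? b))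

NonDecr : List ℕ → Set
NonDecr [] = ⊤
NonDecr (x ∷ []) = ⊤
NonDecr (x ∷ y ∷ l) = (x ≤ y) × NonDecr (y ∷ l)

nonDecr? : ∀ l → Dec (NonDecr l)
nonDecr? [] = yes tt
nonDecr? (x ∷ []) = yes tt
nonDecr? (x ∷ y ∷ l) = (x ≤? y) ×-dec nonDecr? (y ∷ l)

GapsOK : List ℕ → Set
GapsOK [] = ⊤
GapsOK (x ∷ []) = ⊤
GapsOK (x ∷ y ∷ l) = Gap x y × GapsOK (y ∷ l)

gapsOK? : ∀ l → Dec (GapsOK l)
gapsOK? [] = yes tt
gapsOK? (x ∷ []) = yes tt
gapsOK? (x ∷ y ∷ l) = gap? x y ×-dec gapsOK? (y ∷ l)

IsCP0 : ℕ → ℕ → List ℕ → Set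
IsCP0 n m l = (length l ≡ m) × (sum l ≡ n) × All (1 ≤_) l × NonDecr l × GapsOK l

isCP0? : ∀ n m l → Dec (IsCP0 n m l)
isCP0? n m l = (length l ≟ m) ×-dec ((sum l ≟ n) ×-dec (all? (1 ≤?_) l ×-dec (nonDecr? l ×-dec gapsOK? l)))

range1 : ℕ → List ℕ
range1 zero = []
range1 (suc b) = range1 b Data.List.++ (suc b ∷ [])

lists : ℕ → ℕ → List (List ℕ)
lists zero b = [] ∷ []
lists (suc m) b = concatMap (λ x → map (x ∷_) (lists m b)) (range1 b)

-- every part of a partition of n is ≤ n, so the candidates below contain
-- all partitions of n into m parts.
cp0 : ℕ → ℕ → ℕ
cp0 n m = length (filter (isCP0? n m) (lists m n))

-- Formal power series in q with ℕ coefficients (coefficient functions)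

Series : Set
Series = ℕ → ℕ

Σ≤ : ℕ → (ℕ → ℕ) → ℕ
Σ≤ zero f = f zero
Σ≤ (suc n) f = Σ≤ n f + f (suc n)

_⊛_ : Series → Series → Series
(f ⊛ g) n = Σ≤ n (λ i → f i * g (n ∸ i))

one : Series
one zero = 1
one (suc _) = 0

shift : ℕ → Series → Series
shift e f n with e ≤? n
... | yes _ = f (n ∸ e)
... | _ = 0

-- 1 / (1 - q^(suc k)) = Σ_j q^((suc k) j)
geomInv : ℕ → Series
geomInv k n with suc k ∣? n
... | yes _ = 1
... | _ = 0

-- 1 / (q^(suc k); q^(suc k))_j = Π_{i=1}^{j} 1/(1 - q^((suc k) i))
pochInv : ℕ → ℕ → Series
pochInv k zero = one
pochInv k (suc j) = pochInv k j ⊛ geomInv (suc j * suc k ∸ 1)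

δ : ℕ → ℕ → ℕ
δ a b with a ≟ b
... | yes _ = 1
... | _ = 0

baseTerm : ℕ → ℕ → Series
baseTerm n₁ n₂ = shift (6 * n₂ * n₂ + 2 * n₁ * n₁ + 6 * n₂ * n₁) (pochInv 0 n₁ ⊛ pochInv 2 n₂)

-- Coefficient of q^n x^m in
-- Σ_{n₁,n₂≥0} q^{6n₂²+2n₁²+6n₂n₁}(1 + x q^{6n₂+3n₁+1}) x^{2n₂+n₁} / ((q;q)_{n₁}(q³;q³)_{n₂}).
-- Only n₁, n₂ ≤ m can contribute to x^m.
rhsCoeff : ℕ → ℕ → ℕ
rhsCoeff n m =
  Σ≤ m (λ n₂ → Σ≤ m (λ n₁ →
      δ (2 * n₂ + n₁) m * baseTerm n₁ n₂ n
    + δ (2 * n₂ + n₁ + 1) m * shift (6 * n₂ + 3 * n₁ + 1) (baseTerm n₁ n₂) n))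

-- Let From a count, by weight q^|λ| x^(number of parts), the part sequences obeying the gap
-- conditions whose first part is at least a, and After b those that may follow a part b.
-- Splitting off the first part gives From a = x q^a After a + From (a + 1), and the gap
-- conditions show After 1 = From 5, After 3 = From 6, After 4 = From 8 and
-- After 2 = x q⁴ After 4 + From 6. Lowering all parts by 3 preserves the gap conditions
-- (3 ∣ a + b is unaffected) and is the substitution x ↦ x q³, so F₁, F₂, F₃ = From 1, From 2,
-- From 3 satisfy
--   F₁ = x q F₂(x q³) + F₂,
--   F₂ = x² q⁶ F₂(x q⁶) + x q² F₃(x q³) + F₃,
--   F₃ = x q³ F₃(x q³) + F₁(x q³),
-- which together with Fᵢ(0, q) = 1 determine F₁, by induction on the degree in x and then in q.
--
-- On the other side, for S u v = Σ q^(6n₂² + 2n₁² + 6n₂n₁ + u n₁ + v n₂) x^(2n₂ + n₁) / ((q;q)_n₁ (q³;q³)_n₂)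
-- the identity 1/(q;q)_(k+1) = 1/(q;q)_k + q^(k+1)/(q;q)_(k+1) and its analogue in q³ give
--   S u v = S (u + 1) v + x q^(u + 2) S (u + 4) (v + 6),
--   S u v = S u (v + 3) + x² q^(v + 6) S (u + 6) (v + 12),
-- and S u v (x q³) = S (u + 3) (v + 6). From these, S 0 0 + x q S 3 6, S 1 0 + x q² S 4 6 and
-- S 2 3 + x q³ S 5 9 satisfy the same system; the first of them is the right-hand side.

module Submission where

open import Defs
open import Data.Nat using (ℕ; zero; suc; _+_; _*_; _∸_; _≤_; _<_; _≤?_; _≟_; z≤n; s≤s)
open import Data.Nat.Properties
open import Data.Nat.Divisibility using (_∣_; _∣?_; ∣m+n∣m⇒∣n; ∣m∸n∣n⇒∣m; n∣n; ∣⇒≤; ∣m∣n⇒∣m+n; divides)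
open import Data.Nat.Induction using (<-rec)
open import Data.Nat.ListAction using (sum)
open import Data.Nat.ListAction.Properties using (sum-++)
open import Data.Nat.Tactic.RingSolver using (solve-∀)
open import Data.List using (List; []; _∷_; length; filter; map; concatMap; _++_)
open import Data.List.Properties using (length-++; filter-++; map-++; map-cong)
open import Data.List.Relation.Unary.All using (All; []; _∷_)
open import Data.Bool using (true; false; if_then_else_)
open import Data.Product using (_×_; _,_; proj₁)
open import Data.Sum using (inj₁; inj₂)
open import Data.Unit using (⊤; tt)
open import Data.Empty using (⊥-elim)
open import Relation.Nullary using (Dec; yes; no; ¬_; does)
open import Relation.Nullary.Decidable using (_×-dec_; from-yes)
open import Relation.Unary using (Decidable)
open import Relation.Binary.Definitions using (tri<; tri≈; tri>)
open import Relation.Binary.PropositionalEquality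
open import Relation.Binary.Bundles using (Setoid)
import Relation.Binary.Reasoning.Setoid as SetoidReasoning
open import Level using (0ℓ)
open import Algebra.Properties.CommutativeSemigroup +-commutativeSemigroup
  using () renaming (interchange to +-interchange)

indicator : ∀ {p} {P : Set p} → Dec P → ℕ
indicator d = if does d then 1 else 0

indicator-yes : ∀ {p} {P : Set p} (d : Dec P) → P → indicator d ≡ 1
indicator-yes (yes _) _ = refl
indicator-yes (no ¬p) p = ⊥-elim (¬p p)

indicator-no : ∀ {p} {P : Set p} (d : Dec P) → ¬ P → indicator d ≡ 0
indicator-no (yes p) ¬p = ⊥-elim (¬p p)
indicator-no (no _) _ = refl

indicator-⇔ : ∀ {p q} {P : Set p} {Q : Set q} → (P → Q) → (Q → P) →
              (d : Dec P) (e : Dec Q) → indicator d ≡ indicator e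
indicator-⇔ f g (yes p) e = sym (indicator-yes e (f p))
indicator-⇔ f g (no ¬p) e = sym (indicator-no e (λ q → ¬p (g q)))

indicator-× : ∀ {p q} {P : Set p} {Q : Set q} (d : Dec P) (e : Dec Q) →
              indicator (d ×-dec e) ≡ indicator d * indicator e
indicator-× (yes p) (yes q) = refl
indicator-× (yes p) (no _) = refl
indicator-× (no _) e = refl

δ-≡ : ∀ {a b} → a ≡ b → δ a b ≡ 1
δ-≡ {a} {b} e with a ≟ b
... | yes _ = refl
... | no ne = ⊥-elim (ne e)

δ-≢ : ∀ {a b} → ¬ a ≡ b → δ a b ≡ 0
δ-≢ {a} {b} ne with a ≟ b
... | yes e = ⊥-elim (ne e)
... | no _ = refl

δ-suc : ∀ a b → δ (suc a) (suc b) ≡ δ a b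
δ-suc a b with a ≟ b
... | yes e = δ-≡ (cong suc e)
... | no ne = δ-≢ (λ e → ne (suc-injective e))

δ-> : ∀ {a b} → b < a → δ a b ≡ 0
δ-> b<a = δ-≢ (λ e → <⇒≢ b<a (sym e))

shift-≤ : ∀ {e n} (f : Series) → e ≤ n → shift e f n ≡ f (n ∸ e)
shift-≤ {e} {n} f e≤n with e ≤? n
... | yes _ = refl
... | no e≰n = ⊥-elim (e≰n e≤n)

shift-≰ : ∀ {e n} (f : Series) → ¬ e ≤ n → shift e f n ≡ 0
shift-≰ {e} {n} f e≰n with e ≤? n
... | yes e≤n = ⊥-elim (e≰n e≤n)
... | no _ = refl

Σ≤-cong : ∀ n {f g : ℕ → ℕ} → (∀ i → i ≤ n → f i ≡ g i) → Σ≤ n f ≡ Σ≤ n g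
Σ≤-cong zero h = h 0 z≤n
Σ≤-cong (suc n) h = cong₂ _+_ (Σ≤-cong n (λ i i≤n → h i (m≤n⇒m≤1+n i≤n))) (h (suc n) ≤-refl)

Σ≤-distrib-+ : ∀ n (f g : ℕ → ℕ) → Σ≤ n (λ i → f i + g i) ≡ Σ≤ n f + Σ≤ n g
Σ≤-distrib-+ zero f g = refl
Σ≤-distrib-+ (suc n) f g =
  trans (cong (_+ (f (suc n) + g (suc n))) (Σ≤-distrib-+ n f g))
        (+-interchange (Σ≤ n f) (Σ≤ n g) (f (suc n)) (g (suc n)))

Σ≤-zero : ∀ n {f : ℕ → ℕ} → (∀ i → i ≤ n → f i ≡ 0) → Σ≤ n f ≡ 0
Σ≤-zero zero h = h 0 z≤n
Σ≤-zero (suc n) h = cong₂ _+_ (Σ≤-zero n (λ i i≤n → h i (m≤n⇒m≤1+n i≤n))) (h (suc n) ≤-refl)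

Σ≤-suc : ∀ n (f : ℕ → ℕ) → Σ≤ (suc n) f ≡ f 0 + Σ≤ n (λ i → f (suc i))
Σ≤-suc zero f = refl
Σ≤-suc (suc n) f = trans (cong (_+ f (suc (suc n))) (Σ≤-suc n f)) (+-assoc (f 0) _ _)

Σ≤-truncate : ∀ n k {f : ℕ → ℕ} → k ≤ n → (∀ i → k < i → i ≤ n → f i ≡ 0) → Σ≤ n f ≡ Σ≤ k f
Σ≤-truncate n k {f} k≤n h with k ≟ n
... | yes refl = refl
Σ≤-truncate zero k {f} k≤n h | no k≢n = ⊥-elim (k≢n (n≤0⇒n≡0 k≤n))
Σ≤-truncate (suc n) k {f} k≤n h | no k≢n =
  trans (cong (Σ≤ n f +_) (h (suc n) k<1+n ≤-refl))
        (trans (+-identityʳ (Σ≤ n f))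
               (Σ≤-truncate n k (m<1+n⇒m≤n k<1+n) (λ i k<i i≤n → h i k<i (m≤n⇒m≤1+n i≤n))))
  where
  k<1+n : k < suc n
  k<1+n = ≤∧≢⇒< k≤n k≢n

Σ≤-offset : ∀ c n {f : ℕ → ℕ} → (∀ i → i < c → f i ≡ 0) → c ≤ n →
            Σ≤ n f ≡ Σ≤ (n ∸ c) (λ i → f (c + i))
Σ≤-offset zero n h c≤n = refl
Σ≤-offset (suc c) (suc n) {f} h (s≤s c≤n) =
  trans (Σ≤-suc n f)
        (trans (cong (_+ Σ≤ n (λ i → f (suc i))) (h 0 (s≤s z≤n)))
               (Σ≤-offset c n (λ i i<c → h (suc i) (s≤s i<c)) c≤n))

Σ≤-point : ∀ n k {f : ℕ → ℕ} → k ≤ n → (∀ i → i ≤ n → ¬ i ≡ k → f i ≡ 0) → Σ≤ n f ≡ f k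
Σ≤-point n k {f} k≤n h =
  trans (Σ≤-truncate n k k≤n (λ i k<i i≤n → h i i≤n (>⇒≢ k<i)))
        (last k (λ i i<k → h i (≤-trans (<⇒≤ i<k) k≤n) (<⇒≢ i<k)))
  where
  last : ∀ j → (∀ i → i < j → f i ≡ 0) → Σ≤ j f ≡ f j
  last zero _ = refl
  last (suc j) below = cong (_+ f (suc j)) (Σ≤-zero j (λ i i≤j → below i (s≤s i≤j)))

-- Power series in q

infixl 6 _⊕_
_⊕_ : Series → Series → Series
(f ⊕ g) n = f n + g n

one-suc : ∀ {n} → ¬ n ≡ 0 → one n ≡ 0
one-suc {zero} n≢0 = ⊥-elim (n≢0 refl)
one-suc {suc n} _ = refl

⊛-congˡ : ∀ {f f'} g → f ≗ f' → f ⊛ g ≗ f' ⊛ g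
⊛-congˡ g f≗f' n = Σ≤-cong n (λ i _ → cong (_* g (n ∸ i)) (f≗f' i))

⊛-congʳ : ∀ f {g g'} → g ≗ g' → f ⊛ g ≗ f ⊛ g'
⊛-congʳ f g≗g' n = Σ≤-cong n (λ i _ → cong (f i *_) (g≗g' (n ∸ i)))

⊛-distribˡ-⊕ : ∀ f g h → f ⊛ (g ⊕ h) ≗ f ⊛ g ⊕ f ⊛ h
⊛-distribˡ-⊕ f g h n =
  trans (Σ≤-cong n (λ i _ → *-distribˡ-+ (f i) (g (n ∸ i)) (h (n ∸ i)))) (Σ≤-distrib-+ n _ _)

⊛-distribʳ-⊕ : ∀ f g h → (f ⊕ g) ⊛ h ≗ f ⊛ h ⊕ g ⊛ h
⊛-distribʳ-⊕ f g h n =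
  trans (Σ≤-cong n (λ i _ → *-distribʳ-+ (h (n ∸ i)) (f i) (g i))) (Σ≤-distrib-+ n _ _)

⊛-identityʳ : ∀ f → f ⊛ one ≗ f
⊛-identityʳ f n =
  trans (Σ≤-point n n ≤-refl (λ i i≤n i≢n →
           trans (cong (f i *_) (one-suc (m>n⇒m∸n≢0 (≤∧≢⇒< i≤n i≢n)))) (*-zeroʳ (f i))))
        (trans (cong (λ k → f n * one k) (n∸n≡0 n)) (*-identityʳ (f n)))

shift-cong : ∀ {e e'} {f g : Series} → e ≡ e' → f ≗ g → shift e f ≗ shift e' g
shift-cong {e} refl f≗g n with e ≤? n
... | yes _ = f≗g _
... | no _ = refl

shift-congʳ : ∀ e {f g : Series} → f ≗ g → shift e f ≗ shift e g
shift-congʳ e = shift-cong {e} refl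

shift-congˡ : ∀ {e e'} (f : Series) → e ≡ e' → shift e f ≗ shift e' f
shift-congˡ f e≡e' = shift-cong e≡e' (λ _ → refl)

shift-⊕ : ∀ e f g → shift e (f ⊕ g) ≗ shift e f ⊕ shift e g
shift-⊕ e f g n with e ≤? n
... | yes _ = refl
... | no _ = refl

shift-+ : ∀ a b f → shift a (shift b f) ≗ shift (a + b) f
shift-+ a b f n with a ≤? n
... | no a≰n = sym (shift-≰ f (λ a+b≤n → a≰n (≤-trans (m≤m+n a b) a+b≤n)))
... | yes a≤n with b ≤? n ∸ a
...   | yes b≤n∸a = trans (cong f (∸-+-assoc n a b))
                          (sym (shift-≤ f (≤-trans (+-monoʳ-≤ a b≤n∸a) (≤-reflexive (m+[n∸m]≡n a≤n)))))
...   | no b≰n∸a = sym (shift-≰ f (λ a+b≤n →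
                       b≰n∸a (≤-trans (≤-reflexive (sym (m+n∸m≡n a b))) (∸-monoˡ-≤ a a+b≤n))))

*-shift : ∀ c e f → (λ k → c * shift e f k) ≗ shift e (λ k → c * f k)
*-shift c e f k with e ≤? k
... | yes _ = refl
... | no _ = *-zeroʳ c

-- conv h is Σ_b q^b h b, so f ⊛ g is conv (λ b k → f b * g k) by definition.
conv : (ℕ → Series) → Series
conv h n = Σ≤ n (λ b → h b (n ∸ b))

conv-cong : ∀ {h h' : ℕ → Series} → (∀ b → h b ≗ h' b) → conv h ≗ conv h'
conv-cong h≗h' n = Σ≤-cong n (λ b _ → h≗h' b (n ∸ b))

conv-shift : ∀ e h → conv (λ b → shift e (h b)) ≗ shift e (conv h)
conv-shift e h n with e ≤? n
... | yes e≤n =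
  trans (Σ≤-truncate n (n ∸ e) (m∸n≤m n e) (λ b n∸e<b b≤n →
           shift-≰ (h b) (λ e≤n∸b → <⇒≱ n∸e<b (swap b e b≤n e≤n∸b))))
        (Σ≤-cong (n ∸ e) (λ b b≤n∸e →
           trans (shift-≤ (h b) (swap e b e≤n b≤n∸e))
                 (cong (h b) (trans (∸-+-assoc n b e)
                                    (trans (cong (n ∸_) (+-comm b e)) (sym (∸-+-assoc n e b)))))))
  where
  swap : ∀ a b → a ≤ n → b ≤ n ∸ a → a ≤ n ∸ b
  swap a b a≤n b≤n∸a = ≤-trans (≤-reflexive (sym (m+n∸n≡m a b)))
                         (∸-monoˡ-≤ b (≤-trans (+-monoʳ-≤ a b≤n∸a) (≤-reflexive (m+[n∸m]≡n a≤n))))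
... | no e≰n = Σ≤-zero n (λ b _ → shift-≰ (h b) (λ e≤n∸b → e≰n (≤-trans e≤n∸b (m∸n≤m n b))))

conv-offset : ∀ c h → (∀ b → b < c → h b ≗ (λ _ → 0)) → conv h ≗ shift c (conv (λ b → h (c + b)))
conv-offset c h small n with c ≤? n
... | yes c≤n =
  trans (Σ≤-offset c n (λ b b<c → small b b<c (n ∸ b)) c≤n)
        (Σ≤-cong (n ∸ c) (λ b _ → cong (h (c + b)) (sym (∸-+-assoc n c b))))
... | no c≰n = Σ≤-zero n (λ b b≤n → small b (≤-<-trans b≤n (≰⇒> c≰n)) (n ∸ b))

shift-⊛ˡ : ∀ e f g → shift e f ⊛ g ≗ shift e (f ⊛ g)
shift-⊛ˡ e f g n =
  trans (conv-offset e (λ b k → shift e f b * g k)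
                     (λ b b<e k → cong (_* g k) (shift-≰ f (<⇒≱ b<e))) n)
        (shift-congʳ e (conv-cong (λ b k → cong (_* g k)
           (trans (shift-≤ f (m≤m+n e b)) (cong f (m+n∸m≡n e b))))) n)

shift-⊛ʳ : ∀ e f g → f ⊛ shift e g ≗ shift e (f ⊛ g)
shift-⊛ʳ e f g n =
  trans (conv-cong (λ b → *-shift (f b) e g) n) (conv-shift e (λ b k → f b * g k) n)

geomInv-∣ : ∀ {k n} → suc k ∣ n → geomInv k n ≡ 1
geomInv-∣ {k} {n} d with suc k ∣? n
... | yes _ = refl
... | no ∤ = ⊥-elim (∤ d)

geomInv-∤ : ∀ {k n} → ¬ suc k ∣ n → geomInv k n ≡ 0
geomInv-∤ {k} {n} ∤ with suc k ∣? n
... | yes d = ⊥-elim (∤ d)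
... | no _ = refl

geomInv-unfold : ∀ k → geomInv k ≗ one ⊕ shift (suc k) (geomInv k)
geomInv-unfold k zero = cong (1 +_) (sym (shift-≰ {suc k} {0} (geomInv k) (λ ())))
geomInv-unfold k (suc n) with suc k ≤? suc n
... | no k≰n = geomInv-∤ (λ d → k≰n (∣⇒≤ d))
... | yes k≤n with suc k ∣? suc n
...   | yes d = sym (geomInv-∣ (∣m+n∣m⇒∣n (subst (suc k ∣_) (sym (m+[n∸m]≡n k≤n)) d) n∣n))
...   | no ∤ = sym (geomInv-∤ (λ d → ∤ (∣m∸n∣n⇒∣m (suc k) k≤n d n∣n)))

⊛-geomInv-unfold : ∀ f k → f ⊛ geomInv k ≗ f ⊕ shift (suc k) (f ⊛ geomInv k)
⊛-geomInv-unfold f k n = begin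
  (f ⊛ geomInv k) n                                      ≡⟨ ⊛-congʳ f (geomInv-unfold k) n ⟩
  (f ⊛ (one ⊕ shift (suc k) (geomInv k))) n              ≡⟨ ⊛-distribˡ-⊕ f one (shift (suc k) (geomInv k)) n ⟩
  (f ⊛ one) n + (f ⊛ shift (suc k) (geomInv k)) n
    ≡⟨ cong₂ _+_ (⊛-identityʳ f n) (shift-⊛ʳ (suc k) f (geomInv k) n) ⟩
  f n + shift (suc k) (f ⊛ geomInv k) n                  ∎
  where open ≡-Reasoning

-- No arithmetic is needed: suc (suc j * suc s ∸ 1) computes to suc j * suc s.
pochInv-unfold : ∀ s j → pochInv s (suc j) ≗ pochInv s j ⊕ shift (suc j * suc s) (pochInv s (suc j))
pochInv-unfold s j = ⊛-geomInv-unfold (pochInv s j) (suc j * suc s ∸ 1)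

-- Power series in x and q

-- F n m is the coefficient of q^n x^m.
Series₂ : Set
Series₂ = ℕ → ℕ → ℕ

infixl 6 _⊞_
_⊞_ : Series₂ → Series₂ → Series₂
(F ⊞ G) n m = F n m + G n m

infix 4 _≈_
_≈_ : Series₂ → Series₂ → Set
F ≈ G = ∀ n m → F n m ≡ G n m

≈-setoid : Setoid 0ℓ 0ℓ
≈-setoid = record
  { Carrier = Series₂
  ; _≈_ = _≈_
  ; isEquivalence = record
    { refl = λ _ _ → refl
    ; sym = λ F≈G n m → sym (F≈G n m)
    ; trans = λ F≈G G≈H n m → trans (F≈G n m) (G≈H n m)
    }
  }

module ≈-Reasoning = SetoidReasoning ≈-setoid
open Setoid ≈-setoid using () renaming (refl to ≈-refl; trans to ≈-trans)

⊞-cong : ∀ {F F' G G'} → F ≈ F' → G ≈ G' → F ⊞ G ≈ F' ⊞ G'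
⊞-cong F≈F' G≈G' n m = cong₂ _+_ (F≈F' n m) (G≈G' n m)

⊞-comm : ∀ F G → F ⊞ G ≈ G ⊞ F
⊞-comm F G n m = +-comm (F n m) (G n m)

mon : ℕ → ℕ → Series₂ → Series₂
mon zero b F n m = shift b (λ k → F k m) n
mon (suc a) b F n zero = 0
mon (suc a) b F n (suc m) = mon a b F n m

infixr 7 mon
syntax mon a b F = x^ a q^ b · F

-- dilate F is F(x q³).
dilate : Series₂ → Series₂
dilate F n m = shift (3 * m) (λ k → F k m) n

shift-zero : ∀ e → shift e (λ _ → 0) ≗ (λ _ → 0)
shift-zero e n with e ≤? n
... | yes _ = refl
... | no _ = refl

mon-cong : ∀ a b {F G} → F ≈ G → x^ a q^ b · F ≈ x^ a q^ b · G
mon-cong zero b F≈G n m = shift-congʳ b (λ k → F≈G k m) n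
mon-cong (suc a) b F≈G n zero = refl
mon-cong (suc a) b F≈G n (suc m) = mon-cong a b F≈G n m

mon-⊞ : ∀ a b F G → x^ a q^ b · (F ⊞ G) ≈ x^ a q^ b · F ⊞ x^ a q^ b · G
mon-⊞ zero b F G n m = shift-⊕ b _ _ n
mon-⊞ (suc a) b F G n zero = refl
mon-⊞ (suc a) b F G n (suc m) = mon-⊞ a b F G n m

mon-mon : ∀ a b c d F → x^ a q^ b · x^ c q^ d · F ≈ x^ (a + c) q^ (b + d) · F
mon-mon zero b zero d F n m = shift-+ b d (λ k → F k m) n
mon-mon zero b (suc c) d F n zero = shift-zero b n
mon-mon zero b (suc c) d F n (suc m) = mon-mon zero b c d F n m
mon-mon (suc a) b c d F n zero = refl
mon-mon (suc a) b c d F n (suc m) = mon-mon a b c d F n m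

mon-⊞-mon : ∀ a b c d F G → x^ a q^ b · (F ⊞ x^ c q^ d · G) ≈ x^ a q^ b · F ⊞ x^ (a + c) q^ (b + d) · G
mon-⊞-mon a b c d F G n m = trans (mon-⊞ a b F (x^ c q^ d · G) n m) (cong (_ +_) (mon-mon a b c d G n m))

dilate-cong : ∀ {F G} → F ≈ G → dilate F ≈ dilate G
dilate-cong F≈G n m = shift-congʳ (3 * m) (λ k → F≈G k m) n

dilate-⊞ : ∀ F G → dilate (F ⊞ G) ≈ dilate F ⊞ dilate G
dilate-⊞ F G n m = shift-⊕ (3 * m) _ _ n

dilate-mon : ∀ a b F → dilate (x^ a q^ b · F) ≈ x^ a q^ (b + 3 * a) · dilate F
dilate-mon zero b F n m = begin
  shift (3 * m) (shift b (λ k → F k m)) n      ≡⟨ shift-+ (3 * m) b _ n ⟩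
  shift (3 * m + b) (λ k → F k m) n            ≡⟨ shift-congˡ _ (+-comm (3 * m) b) n ⟩
  shift (b + 3 * m) (λ k → F k m) n            ≡⟨ shift-congˡ _ (cong (_+ 3 * m) (+-identityʳ b)) n ⟨
  shift (b + 0 + 3 * m) (λ k → F k m) n        ≡⟨ shift-+ (b + 0) (3 * m) _ n ⟨
  shift (b + 3 * 0) (shift (3 * m) (λ k → F k m)) n ∎
  where open ≡-Reasoning
dilate-mon (suc a) b F n zero = shift-zero 0 n
dilate-mon (suc a) b F n (suc m) = begin
  shift (3 * suc m) (λ k → (x^ a q^ b · F) k m) n              ≡⟨ shift-congˡ _ (*-suc 3 m) n ⟩
  shift (3 + 3 * m) (λ k → (x^ a q^ b · F) k m) n              ≡⟨ shift-+ 3 (3 * m) _ n ⟨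
  shift 3 (λ k → dilate (x^ a q^ b · F) k m) n                 ≡⟨ shift-congʳ 3 (λ k → dilate-mon a b F k m) n ⟩
  shift 3 (λ k → (x^ a q^ (b + 3 * a) · dilate F) k m) n       ≡⟨ mon-mon 0 3 a (b + 3 * a) (dilate F) n m ⟩
  (x^ a q^ (3 + (b + 3 * a)) · dilate F) n m
    ≡⟨ cong (λ e → (x^ a q^ e · dilate F) n m) (exponent a b) ⟩
  (x^ a q^ (b + 3 * suc a) · dilate F) n m                     ∎
  where
  open ≡-Reasoning
  exponent : ∀ a b → 3 + (b + 3 * a) ≡ b + 3 * suc a
  exponent = solve-∀

-- The functional equations determine their solution

record System (F₁ F₂ F₃ : Series₂) : Set where
  field
    eq₁ : F₁ ≈ x^ 1 q^ 1 · dilate F₂ ⊞ F₂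
    eq₂ : F₂ ≈ x^ 2 q^ 6 · dilate (dilate F₂) ⊞ x^ 1 q^ 2 · dilate F₃ ⊞ F₃
    eq₃ : F₃ ≈ x^ 1 q^ 3 · dilate F₃ ⊞ dilate F₁
    const₁ : ∀ n → F₁ n 0 ≡ one n
    const₂ : ∀ n → F₂ n 0 ≡ one n
    const₃ : ∀ n → F₃ n 0 ≡ one n

record AgreeAt (m : ℕ) (F G : Series₂) : Set where
  constructor agreeAt
  field coeff : ∀ n → F n m ≡ G n m
open AgreeAt

dilate-agree : ∀ {m F G} → AgreeAt m F G → AgreeAt m (dilate F) (dilate G)
dilate-agree {m} (agreeAt c) = agreeAt (shift-congʳ (3 * m) c)

mon-agree : ∀ a b {m F G} → AgreeAt m F G → AgreeAt (a + m) (x^ a q^ b · F) (x^ a q^ b · G)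
mon-agree zero b (agreeAt c) = agreeAt (shift-congʳ b c)
mon-agree (suc a) b agree = agreeAt (coeff (mon-agree a b agree))

-- Dilation raises the q-degree by 3(m + 1) > 0 at x-degree m + 1.
dilate-agree-< : ∀ {F G} m n → (∀ k → k < n → F k (suc m) ≡ G k (suc m)) →
                 dilate F n (suc m) ≡ dilate G n (suc m)
dilate-agree-< {F} {G} m n agree with 3 * suc m ≤? n
... | yes 3m+3≤n = agree (n ∸ 3 * suc m) (∸-monoʳ-< (s≤s z≤n) 3m+3≤n)
... | no _ = refl

module _ {F₁ F₂ F₃ G₁ G₂ G₃ : Series₂} (F : System F₁ F₂ F₃) (G : System G₁ G₂ G₃) where

  private
    module F = System F
    module G = System G

  record Agree₃ (n m : ℕ) : Set where
    field
      on₁ : F₁ n m ≡ G₁ n m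
      on₂ : F₂ n m ≡ G₂ n m
      on₃ : F₃ n m ≡ G₃ n m
  open Agree₃

  agree₃ : ∀ m n → Agree₃ n m
  agree₃ = <-rec (λ m → ∀ n → Agree₃ n m) degree
    where
    degree : ∀ m → (∀ {m'} → m' < m → ∀ n → Agree₃ n m') → ∀ n → Agree₃ n m
    degree zero _ n = record
      { on₁ = trans (F.const₁ n) (sym (G.const₁ n))
      ; on₂ = trans (F.const₂ n) (sym (G.const₂ n))
      ; on₃ = trans (F.const₃ n) (sym (G.const₃ n))
      }
    degree (suc m) lower = <-rec (λ n → Agree₃ n (suc m)) qDegree
      where
      previous : ∀ n → Agree₃ n m
      previous = lower ≤-refl

      x²-part : ∀ m → (∀ {m'} → m' < suc m → ∀ n → Agree₃ n m') →
                AgreeAt (suc m) (x^ 2 q^ 6 · dilate (dilate F₂)) (x^ 2 q^ 6 · dilate (dilate G₂))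
      x²-part zero _ = agreeAt (λ _ → refl)
      x²-part (suc m) lower = mon-agree 2 6 (dilate-agree (dilate-agree second))
        where
        second : AgreeAt m F₂ G₂
        second = agreeAt (λ n → on₂ (lower (m<n⇒m<1+n (n<1+n m)) n))

      dilated₂ : AgreeAt m (dilate F₂) (dilate G₂)
      dilated₂ = dilate-agree (agreeAt (λ n → on₂ (previous n)))

      dilated₃ : AgreeAt m (dilate F₃) (dilate G₃)
      dilated₃ = dilate-agree (agreeAt (λ n → on₃ (previous n)))

      qDegree : ∀ n → (∀ {k} → k < n → Agree₃ k (suc m)) → Agree₃ n (suc m)
      qDegree n smaller = record { on₁ = agree-on₁ ; on₂ = agree-on₂ ; on₃ = agree-on₃ }
        where
        open ≡-Reasoning
        agree-on₃ : F₃ n (suc m) ≡ G₃ n (suc m)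
        agree-on₃ = begin
          F₃ n (suc m)                                        ≡⟨ F.eq₃ n (suc m) ⟩
          (x^ 1 q^ 3 · dilate F₃ ⊞ dilate F₁) n (suc m)       ≡⟨ cong₂ _+_
            (coeff (mon-agree 1 3 dilated₃) n)
            (dilate-agree-< {F₁} {G₁} m n (λ k k<n → on₁ (smaller k<n))) ⟩
          (x^ 1 q^ 3 · dilate G₃ ⊞ dilate G₁) n (suc m)       ≡⟨ G.eq₃ n (suc m) ⟨
          G₃ n (suc m)                                        ∎
        agree-on₂ : F₂ n (suc m) ≡ G₂ n (suc m)
        agree-on₂ = begin
          F₂ n (suc m)                                        ≡⟨ F.eq₂ n (suc m) ⟩
          (x^ 2 q^ 6 · dilate (dilate F₂) ⊞ x^ 1 q^ 2 · dilate F₃ ⊞ F₃) n (suc m)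
            ≡⟨ cong₂ _+_ (cong₂ _+_ (coeff (x²-part m lower) n) (coeff (mon-agree 1 2 dilated₃) n))
                         agree-on₃ ⟩
          (x^ 2 q^ 6 · dilate (dilate G₂) ⊞ x^ 1 q^ 2 · dilate G₃ ⊞ G₃) n (suc m)
            ≡⟨ G.eq₂ n (suc m) ⟨
          G₂ n (suc m)                                        ∎
        agree-on₁ : F₁ n (suc m) ≡ G₁ n (suc m)
        agree-on₁ = begin
          F₁ n (suc m)                                        ≡⟨ F.eq₁ n (suc m) ⟩
          (x^ 1 q^ 1 · dilate F₂ ⊞ F₂) n (suc m)              ≡⟨ cong₂ _+_
            (coeff (mon-agree 1 1 dilated₂) n) agree-on₂ ⟩
          (x^ 1 q^ 1 · dilate G₂ ⊞ G₂) n (suc m)              ≡⟨ G.eq₁ n (suc m) ⟨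
          G₁ n (suc m)                                        ∎

  system-unique : F₁ ≈ G₁
  system-unique n m = on₁ (agree₃ m n)

-- The sum side

pochProd : ℕ → ℕ → Series
pochProd n₁ n₂ = pochInv 0 n₁ ⊛ pochInv 2 n₂

quadForm : ℕ → ℕ → ℕ
quadForm n₁ n₂ = 6 * n₂ * n₂ + 2 * n₁ * n₁ + 6 * n₂ * n₁

summand : ℕ → ℕ → ℕ → ℕ → Series
summand u v n₁ n₂ = shift (quadForm n₁ n₂ + u * n₁ + v * n₂) (pochProd n₁ n₂)

-- The coefficient of x^m in Σ_{n₁,n₂} x^(2 n₂ + n₁) H n₁ n₂.
diagSum : ℕ → (ℕ → ℕ → ℕ) → ℕ
diagSum m H = Σ≤ m (λ n₂ → Σ≤ m (λ n₁ → δ (2 * n₂ + n₁) m * H n₁ n₂))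

S : ℕ → ℕ → Series₂
S u v n m = diagSum m (λ n₁ n₂ → summand u v n₁ n₂ n)

pochProd-unfold₁ : ∀ k n₂ → pochProd (suc k) n₂ ≗ pochProd k n₂ ⊕ shift (suc k * 1) (pochProd (suc k) n₂)
pochProd-unfold₁ k n₂ n = begin
  (pochInv 0 (suc k) ⊛ pochInv 2 n₂) n
    ≡⟨ ⊛-congˡ (pochInv 2 n₂) (pochInv-unfold 0 k) n ⟩
  ((pochInv 0 k ⊕ shift (suc k * 1) (pochInv 0 (suc k))) ⊛ pochInv 2 n₂) n
    ≡⟨ ⊛-distribʳ-⊕ (pochInv 0 k) (shift (suc k * 1) (pochInv 0 (suc k))) (pochInv 2 n₂) n ⟩
  pochProd k n₂ n + (shift (suc k * 1) (pochInv 0 (suc k)) ⊛ pochInv 2 n₂) n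
    ≡⟨ cong (pochProd k n₂ n +_) (shift-⊛ˡ (suc k * 1) (pochInv 0 (suc k)) (pochInv 2 n₂) n) ⟩
  pochProd k n₂ n + shift (suc k * 1) (pochProd (suc k) n₂) n
    ∎
  where open ≡-Reasoning

pochProd-unfold₂ : ∀ n₁ j → pochProd n₁ (suc j) ≗ pochProd n₁ j ⊕ shift (suc j * 3) (pochProd n₁ (suc j))
pochProd-unfold₂ n₁ j n = begin
  (pochInv 0 n₁ ⊛ pochInv 2 (suc j)) n
    ≡⟨ ⊛-congʳ (pochInv 0 n₁) (pochInv-unfold 2 j) n ⟩
  (pochInv 0 n₁ ⊛ (pochInv 2 j ⊕ shift (suc j * 3) (pochInv 2 (suc j)))) n
    ≡⟨ ⊛-distribˡ-⊕ (pochInv 0 n₁) (pochInv 2 j) (shift (suc j * 3) (pochInv 2 (suc j))) n ⟩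
  pochProd n₁ j n + (pochInv 0 n₁ ⊛ shift (suc j * 3) (pochInv 2 (suc j))) n
    ≡⟨ cong (pochProd n₁ j n +_) (shift-⊛ʳ (suc j * 3) (pochInv 0 n₁) (pochInv 2 (suc j)) n) ⟩
  pochProd n₁ j n + shift (suc j * 3) (pochProd n₁ (suc j)) n
    ∎
  where open ≡-Reasoning

shift-unfold : ∀ e s {A B : Series} → A ≗ B ⊕ shift s A → shift e A ≗ shift (e + s) A ⊕ shift e B
shift-unfold e s {A} {B} A≗B+qˢA n = begin
  shift e A n                            ≡⟨ shift-congʳ e A≗B+qˢA n ⟩
  shift e (B ⊕ shift s A) n              ≡⟨ shift-⊕ e B (shift s A) n ⟩
  shift e B n + shift e (shift s A) n    ≡⟨ +-comm (shift e B n) _ ⟩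
  shift e (shift s A) n + shift e B n    ≡⟨ cong (_+ shift e B n) (shift-+ e s A n) ⟩
  shift (e + s) A n + shift e B n        ∎
  where open ≡-Reasoning

summand-zero₁ : ∀ u v n₂ → summand u v 0 n₂ ≗ summand (suc u) v 0 n₂
summand-zero₁ u v n₂ = shift-congˡ (pochProd 0 n₂)
  (cong (λ t → quadForm 0 n₂ + t + v * n₂) (trans (*-zeroʳ u) (sym (*-zeroʳ (suc u)))))

summand-suc₁ : ∀ u v k n₂ →
  summand u v (suc k) n₂ ≗ summand (suc u) v (suc k) n₂ ⊕ shift (u + 2) (summand (u + 4) (v + 6) k n₂)
summand-suc₁ u v k n₂ n =
  trans (shift-unfold (quadForm (suc k) n₂ + u * suc k + v * n₂) (suc k * 1) (pochProd-unfold₁ k n₂) n)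
        (cong₂ _+_ (shift-congˡ (pochProd (suc k) n₂) (exponent₊ u v k n₂) n)
                   (trans (shift-congˡ (pochProd k n₂) (exponent₋ u v k n₂) n)
                          (sym (shift-+ (u + 2) _ (pochProd k n₂) n))))
  where
  -- quadForm is unfolded here because the ring solver does not look through definitions.
  exponent₊ : ∀ u v k n₂ → (6 * n₂ * n₂ + 2 * (suc k) * (suc k) + 6 * n₂ * (suc k)) + u * suc k + v * n₂ + suc k * 1
                         ≡ (6 * n₂ * n₂ + 2 * (suc k) * (suc k) + 6 * n₂ * (suc k)) + suc u * suc k + v * n₂
  exponent₊ = solve-∀
  exponent₋ : ∀ u v k n₂ → (6 * n₂ * n₂ + 2 * (suc k) * (suc k) + 6 * n₂ * (suc k)) + u * suc k + v * n₂
                         ≡ u + 2 + ((6 * n₂ * n₂ + 2 * k * k + 6 * n₂ * k) + (u + 4) * k + (v + 6) * n₂)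
  exponent₋ = solve-∀

summand-zero₂ : ∀ u v n₁ → summand u v n₁ 0 ≗ summand u (v + 3) n₁ 0
summand-zero₂ u v n₁ = shift-congˡ (pochProd n₁ 0)
  (cong (quadForm n₁ 0 + u * n₁ +_) (trans (*-zeroʳ v) (sym (*-zeroʳ (v + 3)))))

summand-suc₂ : ∀ u v n₁ j →
  summand u v n₁ (suc j) ≗ summand u (v + 3) n₁ (suc j) ⊕ shift (v + 6) (summand (u + 6) (v + 12) n₁ j)
summand-suc₂ u v n₁ j n =
  trans (shift-unfold (quadForm n₁ (suc j) + u * n₁ + v * suc j) (suc j * 3) (pochProd-unfold₂ n₁ j) n)
        (cong₂ _+_ (shift-congˡ (pochProd n₁ (suc j)) (exponent₊ u v n₁ j) n)
                   (trans (shift-congˡ (pochProd n₁ j) (exponent₋ u v n₁ j) n)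
                          (sym (shift-+ (v + 6) _ (pochProd n₁ j) n))))
  where
  exponent₊ : ∀ u v n₁ j → (6 * (suc j) * (suc j) + 2 * n₁ * n₁ + 6 * (suc j) * n₁) + u * n₁ + v * suc j + suc j * 3
                         ≡ (6 * (suc j) * (suc j) + 2 * n₁ * n₁ + 6 * (suc j) * n₁) + u * n₁ + (v + 3) * suc j
  exponent₊ = solve-∀
  exponent₋ : ∀ u v n₁ j → (6 * (suc j) * (suc j) + 2 * n₁ * n₁ + 6 * (suc j) * n₁) + u * n₁ + v * suc j
                         ≡ v + 6 + ((6 * j * j + 2 * n₁ * n₁ + 6 * j * n₁) + (u + 6) * n₁ + (v + 12) * j)
  exponent₋ = solve-∀

delay₁ : (ℕ → ℕ → ℕ) → ℕ → ℕ → ℕ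
delay₁ H zero n₂ = 0
delay₁ H (suc n₁) n₂ = H n₁ n₂

delay₂ : (ℕ → ℕ → ℕ) → ℕ → ℕ → ℕ
delay₂ H n₁ zero = 0
delay₂ H n₁ (suc n₂) = H n₁ n₂

diagSum-cong : ∀ m {H H' : ℕ → ℕ → ℕ} → (∀ n₁ n₂ → 2 * n₂ + n₁ ≡ m → H n₁ n₂ ≡ H' n₁ n₂) →
               diagSum m H ≡ diagSum m H'
diagSum-cong m {H} {H'} H≡H' = Σ≤-cong m (λ n₂ _ → Σ≤-cong m (λ n₁ _ → term n₁ n₂ (2 * n₂ + n₁ ≟ m)))
  where
  term : ∀ n₁ n₂ → Dec (2 * n₂ + n₁ ≡ m) → δ (2 * n₂ + n₁) m * H n₁ n₂ ≡ δ (2 * n₂ + n₁) m * H' n₁ n₂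
  term n₁ n₂ (yes on) = cong (δ (2 * n₂ + n₁) m *_) (H≡H' n₁ n₂ on)
  term n₁ n₂ (no off) rewrite δ-≢ off = refl

diagSum-distrib-+ : ∀ m (H H' : ℕ → ℕ → ℕ) → diagSum m (λ n₁ n₂ → H n₁ n₂ + H' n₁ n₂) ≡ diagSum m H + diagSum m H'
diagSum-distrib-+ m H H' =
  trans (Σ≤-cong m (λ n₂ _ →
           trans (Σ≤-cong m (λ n₁ _ → *-distribˡ-+ (δ (2 * n₂ + n₁) m) (H n₁ n₂) (H' n₁ n₂)))
                 (Σ≤-distrib-+ m _ _)))
        (Σ≤-distrib-+ m _ _)

diagSum-widen : ∀ m k₁ k₂ H → m ≤ k₁ → m ≤ k₂ →
                Σ≤ k₂ (λ n₂ → Σ≤ k₁ (λ n₁ → δ (2 * n₂ + n₁) m * H n₁ n₂)) ≡ diagSum m H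
diagSum-widen m k₁ k₂ H m≤k₁ m≤k₂ =
  trans (Σ≤-truncate k₂ m m≤k₂ (λ n₂ m<n₂ _ → Σ≤-zero k₁ (λ n₁ _ →
           cong (_* H n₁ n₂) (δ-> (≤-trans m<n₂ (≤-trans (m≤m+n n₂ (n₂ + 0)) (m≤m+n (2 * n₂) n₁)))))))
        (Σ≤-cong m (λ n₂ _ → Σ≤-truncate k₁ m m≤k₁ (λ n₁ m<n₁ _ →
           cong (_* H n₁ n₂) (δ-> (≤-trans m<n₁ (m≤n+m n₁ (2 * n₂)))))))

diagSum-delay₁ : ∀ m H → diagSum (suc m) (delay₁ H) ≡ diagSum m H
diagSum-delay₁ m H = trans (Σ≤-cong (suc m) (λ n₂ _ → row n₂)) (diagSum-widen m m (suc m) H ≤-refl (n≤1+n m))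
  where
  row : ∀ n₂ → Σ≤ (suc m) (λ n₁ → δ (2 * n₂ + n₁) (suc m) * delay₁ H n₁ n₂)
             ≡ Σ≤ m (λ n₁ → δ (2 * n₂ + n₁) m * H n₁ n₂)
  row n₂ = trans (Σ≤-suc m _)
                 (cong₂ _+_ (*-zeroʳ (δ (2 * n₂ + 0) (suc m)))
                            (Σ≤-cong m (λ n₁ _ → cong (_* H n₁ n₂)
                               (trans (cong (λ d → δ d (suc m)) (+-suc (2 * n₂) n₁)) (δ-suc (2 * n₂ + n₁) m)))))

diagSum-delay₂ : ∀ m H → diagSum (suc (suc m)) (delay₂ H) ≡ diagSum m H
diagSum-delay₂ m H =
  trans (Σ≤-suc (suc m) _)
        (trans (cong₂ _+_ (Σ≤-zero (suc (suc m)) (λ n₁ _ → *-zeroʳ (δ (2 * 0 + n₁) (suc (suc m)))))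
                          (Σ≤-cong (suc m) (λ n₂ _ → Σ≤-cong (suc (suc m)) (λ n₁ _ →
                             cong (_* H n₁ n₂) (lower n₁ n₂)))))
               (diagSum-widen m (suc (suc m)) (suc m) H (m≤n⇒m≤1+n (n≤1+n m)) (n≤1+n m)))
  where
  lower : ∀ n₁ n₂ → δ (2 * suc n₂ + n₁) (suc (suc m)) ≡ δ (2 * n₂ + n₁) m
  lower n₁ n₂ = trans (cong (λ d → δ d (suc (suc m))) (degree n₂ n₁)) (trans (δ-suc _ _) (δ-suc _ _))
    where
    degree : ∀ n₂ n₁ → 2 * suc n₂ + n₁ ≡ suc (suc (2 * n₂ + n₁))
    degree = solve-∀

shift-diagSum : ∀ e m (F : ℕ → ℕ → Series) →
                shift e (λ k → diagSum m (λ n₁ n₂ → F n₁ n₂ k)) ≗ (λ n → diagSum m (λ n₁ n₂ → shift e (F n₁ n₂) n))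
shift-diagSum e m F n with e ≤? n
... | yes _ = refl
... | no _ = sym (Σ≤-zero m (λ n₂ _ → Σ≤-zero m (λ n₁ _ → *-zeroʳ (δ (2 * n₂ + n₁) m))))

S-split₁ : ∀ u v → S u v ≈ S (suc u) v ⊞ x^ 1 q^ (u + 2) · S (u + 4) (v + 6)
S-split₁ u v n m = begin
  S u v n m
    ≡⟨ diagSum-cong m (λ n₁ n₂ _ → split n₁ n₂) ⟩
  diagSum m (λ n₁ n₂ → summand (suc u) v n₁ n₂ n + delay₁ H n₁ n₂)
    ≡⟨ diagSum-distrib-+ m _ (delay₁ H) ⟩
  S (suc u) v n m + diagSum m (delay₁ H)
    ≡⟨ cong (S (suc u) v n m +_) (delayed m) ⟩
  S (suc u) v n m + (x^ 1 q^ (u + 2) · S (u + 4) (v + 6)) n m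
    ∎
  where
  open ≡-Reasoning
  H : ℕ → ℕ → ℕ
  H n₁ n₂ = shift (u + 2) (summand (u + 4) (v + 6) n₁ n₂) n
  split : ∀ n₁ n₂ → summand u v n₁ n₂ n ≡ summand (suc u) v n₁ n₂ n + delay₁ H n₁ n₂
  split zero n₂ = trans (summand-zero₁ u v n₂ n) (sym (+-identityʳ _))
  split (suc k) n₂ = summand-suc₁ u v k n₂ n
  delayed : ∀ m → diagSum m (delay₁ H) ≡ (x^ 1 q^ (u + 2) · S (u + 4) (v + 6)) n m
  delayed zero = refl
  delayed (suc m) = trans (diagSum-delay₁ m H) (sym (shift-diagSum (u + 2) m (summand (u + 4) (v + 6)) n))

S-split₂ : ∀ u v → S u v ≈ S u (v + 3) ⊞ x^ 2 q^ (v + 6) · S (u + 6) (v + 12)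
S-split₂ u v n m = begin
  S u v n m
    ≡⟨ diagSum-cong m (λ n₁ n₂ _ → split n₁ n₂) ⟩
  diagSum m (λ n₁ n₂ → summand u (v + 3) n₁ n₂ n + delay₂ H n₁ n₂)
    ≡⟨ diagSum-distrib-+ m _ (delay₂ H) ⟩
  S u (v + 3) n m + diagSum m (delay₂ H)
    ≡⟨ cong (S u (v + 3) n m +_) (delayed m) ⟩
  S u (v + 3) n m + (x^ 2 q^ (v + 6) · S (u + 6) (v + 12)) n m
    ∎
  where
  open ≡-Reasoning
  H : ℕ → ℕ → ℕ
  H n₁ n₂ = shift (v + 6) (summand (u + 6) (v + 12) n₁ n₂) n
  split : ∀ n₁ n₂ → summand u v n₁ n₂ n ≡ summand u (v + 3) n₁ n₂ n + delay₂ H n₁ n₂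
  split n₁ zero = trans (summand-zero₂ u v n₁ n) (sym (+-identityʳ _))
  split n₁ (suc j) = summand-suc₂ u v n₁ j n
  delayed : ∀ m → diagSum m (delay₂ H) ≡ (x^ 2 q^ (v + 6) · S (u + 6) (v + 12)) n m
  delayed zero = refl
  delayed (suc zero) = refl
  delayed (suc (suc m)) = trans (diagSum-delay₂ m H) (sym (shift-diagSum (v + 6) m (summand (u + 6) (v + 12)) n))

dilate-S : ∀ u v → dilate (S u v) ≈ S (u + 3) (v + 6)
dilate-S u v n m =
  trans (shift-diagSum (3 * m) m (summand u v) n)
        (diagSum-cong m (λ n₁ n₂ on → trans (shift-+ (3 * m) _ (pochProd n₁ n₂) n)
                                            (shift-congˡ (pochProd n₁ n₂) (exponent n₁ n₂ on) n)))
  where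
  exponent : ∀ n₁ n₂ → 2 * n₂ + n₁ ≡ m →
             3 * m + (quadForm n₁ n₂ + u * n₁ + v * n₂) ≡ quadForm n₁ n₂ + (u + 3) * n₁ + (v + 6) * n₂
  exponent n₁ n₂ refl = identity (quadForm n₁ n₂) u v n₁ n₂
    where
    identity : ∀ Q u v n₁ n₂ → 3 * (2 * n₂ + n₁) + (Q + u * n₁ + v * n₂) ≡ Q + (u + 3) * n₁ + (v + 6) * n₂
    identity = solve-∀

mon-S-split₁ : ∀ a b u v →
  x^ a q^ b · S u v ≈ x^ a q^ b · S (suc u) v ⊞ x^ (a + 1) q^ (b + (u + 2)) · S (u + 4) (v + 6)
mon-S-split₁ a b u v = ≈-trans (mon-cong a b (S-split₁ u v)) (mon-⊞-mon a b 1 (u + 2) _ _)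

mon-S-split₂ : ∀ a b u v →
  x^ a q^ b · S u v ≈ x^ a q^ b · S u (v + 3) ⊞ x^ (a + 2) q^ (b + (v + 6)) · S (u + 6) (v + 12)
mon-S-split₂ a b u v = ≈-trans (mon-cong a b (S-split₂ u v)) (mon-⊞-mon a b 2 (v + 6) _ _)

twoTerm : ℕ → ℕ → ℕ → ℕ → ℕ → Series₂
twoTerm u v w u' v' = S u v ⊞ x^ 1 q^ w · S u' v'

dilate-twoTerm : ∀ u v w u' v' →
  dilate (twoTerm u v w u' v') ≈ twoTerm (u + 3) (v + 6) (w + 3) (u' + 3) (v' + 6)
dilate-twoTerm u v w u' v' =
  ≈-trans (dilate-⊞ (S u v) (x^ 1 q^ w · S u' v'))
          (⊞-cong (dilate-S u v) (≈-trans (dilate-mon 1 w (S u' v')) (mon-cong 1 (w + 3) (dilate-S u' v'))))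

mon-dilate-twoTerm : ∀ a b u v w u' v' →
  x^ a q^ b · dilate (twoTerm u v w u' v')
    ≈ x^ a q^ b · S (u + 3) (v + 6) ⊞ x^ (a + 1) q^ (b + (w + 3)) · S (u' + 3) (v' + 6)
mon-dilate-twoTerm a b u v w u' v' =
  ≈-trans (mon-cong a b (dilate-twoTerm u v w u' v')) (mon-⊞-mon a b 1 (w + 3) _ _)

R₁ R₂ R₃ : Series₂
R₁ = twoTerm 0 0 1 3 6
R₂ = twoTerm 1 0 2 4 6
R₃ = twoTerm 2 3 3 5 9

R-eq₁ : R₁ ≈ x^ 1 q^ 1 · dilate R₂ ⊞ R₂
R-eq₁ = begin
  S 0 0 ⊞ x^ 1 q^ 1 · S 3 6
    ≈⟨ ⊞-cong (S-split₁ 0 0) (mon-S-split₁ 1 1 3 6) ⟩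
  (S 1 0 ⊞ x^ 1 q^ 2 · S 4 6) ⊞ (x^ 1 q^ 1 · S 4 6 ⊞ x^ 2 q^ 6 · S 7 12)
    ≈⟨ ⊞-comm R₂ (x^ 1 q^ 1 · S 4 6 ⊞ x^ 2 q^ 6 · S 7 12) ⟩
  (x^ 1 q^ 1 · S 4 6 ⊞ x^ 2 q^ 6 · S 7 12) ⊞ R₂
    ≈⟨ ⊞-cong (mon-dilate-twoTerm 1 1 1 0 2 4 6) ≈-refl ⟨
  x^ 1 q^ 1 · dilate R₂ ⊞ R₂
    ∎
  where open ≈-Reasoning

R-eq₂ : R₂ ≈ x^ 2 q^ 6 · dilate (dilate R₂) ⊞ x^ 1 q^ 2 · dilate R₃ ⊞ R₃
R-eq₂ = begin
  S 1 0 ⊞ x^ 1 q^ 2 · S 4 6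
    ≈⟨ ⊞-cong (S-split₁ 1 0) (mon-S-split₁ 1 2 4 6) ⟩
  (S 2 0 ⊞ x^ 1 q^ 3 · S 5 6) ⊞ (x^ 1 q^ 2 · S 5 6 ⊞ x^ 2 q^ 8 · S 8 12)
    ≈⟨ ⊞-cong (⊞-cong (S-split₂ 2 0) (mon-S-split₂ 1 3 5 6))
              (⊞-cong (mon-S-split₂ 1 2 5 6) (mon-S-split₂ 2 8 8 12)) ⟩
  (S 2 3 ⊞ x^ 2 q^ 6 · S 8 12 ⊞ (x^ 1 q^ 3 · S 5 9 ⊞ x^ 3 q^ 15 · S 11 18))
    ⊞ (x^ 1 q^ 2 · S 5 9 ⊞ x^ 3 q^ 14 · S 11 18 ⊞ (x^ 2 q^ 8 · S 8 15 ⊞ x^ 4 q^ 26 · S 14 24))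
    ≈⟨ regroup (S 2 3) (x^ 2 q^ 6 · S 8 12) (x^ 1 q^ 3 · S 5 9) (x^ 3 q^ 15 · S 11 18)
               (x^ 1 q^ 2 · S 5 9) (x^ 3 q^ 14 · S 11 18) (x^ 2 q^ 8 · S 8 15) (x^ 4 q^ 26 · S 14 24) ⟩
  (x^ 2 q^ 6 · S 8 12 ⊞ x^ 3 q^ 15 · S 11 18 ⊞ (x^ 3 q^ 14 · S 11 18 ⊞ x^ 4 q^ 26 · S 14 24))
    ⊞ (x^ 1 q^ 2 · S 5 9 ⊞ x^ 2 q^ 8 · S 8 15) ⊞ R₃
    ≈⟨ ⊞-cong (⊞-cong (⊞-cong (mon-S-split₁ 2 6 7 12) (mon-S-split₁ 3 14 10 18)) ≈-refl) ≈-refl ⟨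
  (x^ 2 q^ 6 · S 7 12 ⊞ x^ 3 q^ 14 · S 10 18) ⊞ (x^ 1 q^ 2 · S 5 9 ⊞ x^ 2 q^ 8 · S 8 15) ⊞ R₃
    ≈⟨ ⊞-cong (⊞-cong (≈-trans (mon-cong 2 6 (dilate-cong (dilate-twoTerm 1 0 2 4 6)))
                               (mon-dilate-twoTerm 2 6 4 6 5 7 12))
                      (mon-dilate-twoTerm 1 2 2 3 3 5 9))
              ≈-refl ⟨
  x^ 2 q^ 6 · dilate (dilate R₂) ⊞ x^ 1 q^ 2 · dilate R₃ ⊞ R₃
    ∎
  where
  open ≈-Reasoning
  regroup : ∀ A B C D E F G H →
            (A ⊞ B ⊞ (C ⊞ D)) ⊞ (E ⊞ F ⊞ (G ⊞ H)) ≈ (B ⊞ D ⊞ (F ⊞ H)) ⊞ (E ⊞ G) ⊞ (A ⊞ C)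
  regroup A B C D E F G H n m = identity (A n m) (B n m) (C n m) (D n m) (E n m) (F n m) (G n m) (H n m)
    where
    identity : ∀ a b c d e f g h → (a + b + (c + d)) + (e + f + (g + h)) ≡ (b + d + (f + h)) + (e + g) + (a + c)
    identity = solve-∀

R-eq₃ : R₃ ≈ x^ 1 q^ 3 · dilate R₃ ⊞ dilate R₁
R-eq₃ = begin
  S 2 3 ⊞ x^ 1 q^ 3 · S 5 9
    ≈⟨ ⊞-cong (≈-trans (S-split₁ 2 3) (⊞-cong (S-split₂ 3 3) (mon-S-split₂ 1 4 6 9))) ≈-refl ⟩
  (S 3 6 ⊞ x^ 2 q^ 9 · S 9 15 ⊞ (x^ 1 q^ 4 · S 6 12 ⊞ x^ 3 q^ 19 · S 12 21)) ⊞ x^ 1 q^ 3 · S 5 9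
    ≈⟨ regroup (S 3 6) (x^ 2 q^ 9 · S 9 15) (x^ 1 q^ 4 · S 6 12) (x^ 3 q^ 19 · S 12 21) (x^ 1 q^ 3 · S 5 9) ⟩
  (x^ 1 q^ 3 · S 5 9 ⊞ (x^ 2 q^ 9 · S 9 15 ⊞ x^ 3 q^ 19 · S 12 21)) ⊞ (S 3 6 ⊞ x^ 1 q^ 4 · S 6 12)
    ≈⟨ ⊞-cong (⊞-cong (≈-refl {x^ 1 q^ 3 · S 5 9}) (mon-S-split₁ 2 9 8 15)) ≈-refl ⟨
  (x^ 1 q^ 3 · S 5 9 ⊞ x^ 2 q^ 9 · S 8 15) ⊞ (S 3 6 ⊞ x^ 1 q^ 4 · S 6 12)
    ≈⟨ ⊞-cong (mon-dilate-twoTerm 1 3 2 3 3 5 9) (dilate-twoTerm 0 0 1 3 6) ⟨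
  x^ 1 q^ 3 · dilate R₃ ⊞ dilate R₁
    ∎
  where
  open ≈-Reasoning
  regroup : ∀ A B C D E → (A ⊞ B ⊞ (C ⊞ D)) ⊞ E ≈ E ⊞ (B ⊞ D) ⊞ (A ⊞ C)
  regroup A B C D E n m = identity (A n m) (B n m) (C n m) (D n m) (E n m)
    where
    identity : ∀ a b c d e → (a + b + (c + d)) + e ≡ e + (b + d) + (a + c)
    identity = solve-∀

S-const : ∀ u v n → S u v n 0 ≡ one n
S-const u v n = begin
  summand u v 0 0 n + 0                        ≡⟨ +-identityʳ _ ⟩
  shift (0 + u * 0 + v * 0) (one ⊛ one) n      ≡⟨ shift-cong (exponent u v) (⊛-identityʳ one) n ⟩
  shift 0 one n                                ≡⟨ shift-≤ one z≤n ⟩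
  one n                                        ∎
  where
  open ≡-Reasoning
  exponent : ∀ u v → 0 + u * 0 + v * 0 ≡ 0
  exponent = solve-∀

twoTerm-const : ∀ u v w u' v' n → twoTerm u v w u' v' n 0 ≡ one n
twoTerm-const u v w u' v' n = trans (+-identityʳ _) (S-const u v n)

R-system : System R₁ R₂ R₃
R-system = record
  { eq₁ = R-eq₁ ; eq₂ = R-eq₂ ; eq₃ = R-eq₃
  ; const₁ = twoTerm-const 0 0 1 3 6
  ; const₂ = twoTerm-const 1 0 2 4 6
  ; const₃ = twoTerm-const 2 3 3 5 9
  }

rhsCoeff≡R₁ : ∀ n m → rhsCoeff n m ≡ R₁ n m
rhsCoeff≡R₁ n m = begin
  rhsCoeff n m
    ≡⟨ Σ≤-cong m (λ n₂ _ → Σ≤-distrib-+ m _ _) ⟩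
  Σ≤ m (λ n₂ → Σ≤ m (λ n₁ → δ (2 * n₂ + n₁) m * baseTerm n₁ n₂ n)
             + Σ≤ m (λ n₁ → δ (2 * n₂ + n₁ + 1) m * X n₁ n₂))
    ≡⟨ Σ≤-distrib-+ m _ _ ⟩
  diagSum m (λ n₁ n₂ → baseTerm n₁ n₂ n) + Σ≤ m (λ n₂ → Σ≤ m (λ n₁ → δ (2 * n₂ + n₁ + 1) m * X n₁ n₂))
    ≡⟨ cong₂ _+_ (diagSum-cong m (λ n₁ n₂ _ → shift-congˡ (pochProd n₁ n₂) (exponent₀ n₁ n₂) n)) (shifted m) ⟩
  S 0 0 n m + (x^ 1 q^ 1 · S 3 6) n m
    ∎
  where
  open ≡-Reasoning
  X : ℕ → ℕ → ℕ
  X n₁ n₂ = shift (6 * n₂ + 3 * n₁ + 1) (baseTerm n₁ n₂) n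
  exponent₀ : ∀ n₁ n₂ → quadForm n₁ n₂ ≡ quadForm n₁ n₂ + 0 * n₁ + 0 * n₂
  exponent₀ n₁ n₂ = sym (trans (+-identityʳ _) (+-identityʳ _))
  exponent₁ : ∀ n₁ n₂ → 6 * n₂ + 3 * n₁ + 1 + quadForm n₁ n₂ ≡ 1 + (quadForm n₁ n₂ + 3 * n₁ + 6 * n₂)
  exponent₁ n₁ n₂ = identity (quadForm n₁ n₂) n₁ n₂
    where
    identity : ∀ Q n₁ n₂ → 6 * n₂ + 3 * n₁ + 1 + Q ≡ 1 + (Q + 3 * n₁ + 6 * n₂)
    identity = solve-∀
  shifted : ∀ m → Σ≤ m (λ n₂ → Σ≤ m (λ n₁ → δ (2 * n₂ + n₁ + 1) m * X n₁ n₂)) ≡ (x^ 1 q^ 1 · S 3 6) n m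
  shifted zero = refl
  shifted (suc m) = begin
    Σ≤ (suc m) (λ n₂ → Σ≤ (suc m) (λ n₁ → δ (2 * n₂ + n₁ + 1) (suc m) * X n₁ n₂))
      ≡⟨ Σ≤-cong (suc m) (λ n₂ _ → Σ≤-cong (suc m) (λ n₁ _ → cong (_* X n₁ n₂)
           (trans (cong (λ d → δ d (suc m)) (+-comm (2 * n₂ + n₁) 1)) (δ-suc (2 * n₂ + n₁) m)))) ⟩
    Σ≤ (suc m) (λ n₂ → Σ≤ (suc m) (λ n₁ → δ (2 * n₂ + n₁) m * X n₁ n₂))
      ≡⟨ diagSum-widen m (suc m) (suc m) X (n≤1+n m) (n≤1+n m) ⟩
    diagSum m X
      ≡⟨ diagSum-cong m (λ n₁ n₂ _ → trans (shift-+ (6 * n₂ + 3 * n₁ + 1) (quadForm n₁ n₂) (pochProd n₁ n₂) n)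
                                     (trans (shift-congˡ (pochProd n₁ n₂) (exponent₁ n₁ n₂) n)
                                            (sym (shift-+ 1 _ (pochProd n₁ n₂) n)))) ⟩
    diagSum m (λ n₁ n₂ → shift 1 (summand 3 6 n₁ n₂) n)
      ≡⟨ shift-diagSum 1 m (summand 3 6) n ⟨
    (x^ 1 q^ 1 · S 3 6) n (suc m)
      ∎

-- The partition side

-- After x n m counts the part sequences b₁, …, b_m with sum n such that Gap x b₁ and Gap bᵢ bᵢ₊₁;
-- From a n m counts those with a ≤ b₁ instead of Gap x b₁.
After : ℕ → Series₂
After x n zero = one n
After x n (suc m) = conv (λ b k → indicator (gap? x b) * After b k m) n

From : ℕ → Series₂
From a n zero = one n
From a n (suc m) = conv (λ b k → indicator (a ≤? b) * After b k m) n

conv-pick : ∀ a (W : ℕ → Series) → conv (λ b k → indicator (a ≟ b) * W b k) ≗ shift a (W a)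
conv-pick a W n with a ≤? n
... | yes a≤n =
  trans (Σ≤-point n a a≤n (λ b _ b≢a → cong (_* W b (n ∸ b)) (indicator-no (a ≟ b) (λ a≡b → b≢a (sym a≡b)))))
        (trans (cong (_* W a (n ∸ a)) (indicator-yes (a ≟ a) refl)) (*-identityˡ (W a (n ∸ a))))
... | no a≰n = Σ≤-zero n (λ b b≤n →
  cong (_* W b (n ∸ b)) (indicator-no (a ≟ b) (λ a≡b → a≰n (subst (_≤ n) (sym a≡b) b≤n))))

indicator-≤-split : ∀ a b → indicator (a ≤? b) ≡ indicator (a ≟ b) + indicator (suc a ≤? b)
indicator-≤-split a b with <-cmp a b
... | tri< a<b a≢b _ =
  trans (indicator-yes (a ≤? b) (<⇒≤ a<b))
        (sym (cong₂ _+_ (indicator-no (a ≟ b) a≢b) (indicator-yes (suc a ≤? b) a<b)))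
... | tri≈ _ a≡b _ =
  trans (indicator-yes (a ≤? b) (≤-reflexive a≡b))
        (sym (cong₂ _+_ (indicator-yes (a ≟ b) a≡b) (indicator-no (suc a ≤? b) (λ a<b → <⇒≢ a<b a≡b))))
... | tri> _ a≢b b<a =
  trans (indicator-no (a ≤? b) (<⇒≱ b<a))
        (sym (cong₂ _+_ (indicator-no (a ≟ b) a≢b) (indicator-no (suc a ≤? b) (λ a<b → <⇒≱ b<a (<⇒≤ a<b)))))

conv-split-pick : ∀ a (c c' : ℕ → ℕ) (W : ℕ → Series) → (∀ b → c b ≡ indicator (a ≟ b) + c' b) →
                  conv (λ b k → c b * W b k) ≗ shift a (W a) ⊕ conv (λ b k → c' b * W b k)
conv-split-pick a c c' W c≡ n =
  trans (conv-cong (λ b k → trans (cong (_* W b k) (c≡ b)) (*-distribʳ-+ (W b k) (indicator (a ≟ b)) (c' b))) n)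
        (trans (Σ≤-distrib-+ n _ _) (cong (_+ conv (λ b k → c' b * W b k) n) (conv-pick a W n)))

From-split : ∀ a → From a ≈ x^ 1 q^ a · After a ⊞ From (suc a)
From-split a n zero = refl
From-split a n (suc m) = conv-split-pick a _ _ (λ b k → After b k m) (indicator-≤-split a) n

After≈From : ∀ x c → (∀ b → indicator (gap? x b) ≡ indicator (c ≤? b)) → After x ≈ From c
After≈From x c same n zero = refl
After≈From x c same n (suc m) = conv-cong (λ b k → cong (_* After b k m) (same b)) n

gap-1 : ∀ b → indicator (gap? 1 b) ≡ indicator (5 ≤? b)
gap-1 0 = refl
gap-1 1 = refl
gap-1 2 = refl
gap-1 3 = refl
gap-1 4 = refl
gap-1 b@(suc (suc (suc (suc (suc _))))) =
  indicator-yes (gap? 1 b) (from-yes (3 ≤? b) , inj₂ (from-yes (5 ≤? b)))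

gap-3 : ∀ b → indicator (gap? 3 b) ≡ indicator (6 ≤? b)
gap-3 0 = refl
gap-3 1 = refl
gap-3 2 = refl
gap-3 3 = refl
gap-3 4 = refl
gap-3 5 = refl
gap-3 6 = refl
gap-3 b@(suc (suc (suc (suc (suc (suc (suc _))))))) =
  indicator-yes (gap? 3 b) (from-yes (5 ≤? b) , inj₂ (from-yes (7 ≤? b)))

gap-4 : ∀ b → indicator (gap? 4 b) ≡ indicator (8 ≤? b)
gap-4 0 = refl
gap-4 1 = refl
gap-4 2 = refl
gap-4 3 = refl
gap-4 4 = refl
gap-4 5 = refl
gap-4 6 = refl
gap-4 7 = refl
gap-4 b@(suc (suc (suc (suc (suc (suc (suc (suc _)))))))) =
  indicator-yes (gap? 4 b) (from-yes (6 ≤? b) , inj₂ (from-yes (8 ≤? b)))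

gap-2 : ∀ b → indicator (gap? 2 b) ≡ indicator (4 ≟ b) + indicator (6 ≤? b)
gap-2 0 = refl
gap-2 1 = refl
gap-2 2 = refl
gap-2 3 = refl
gap-2 4 = refl
gap-2 5 = refl
gap-2 b@(suc (suc (suc (suc (suc (suc _)))))) =
  indicator-yes (gap? 2 b) (from-yes (4 ≤? b) , inj₂ (from-yes (6 ≤? b)))

After-2 : After 2 ≈ x^ 1 q^ 4 · After 4 ⊞ From 6
After-2 n zero = refl
After-2 n (suc m) = conv-split-pick 4 _ _ (λ b k → After b k m) gap-2 n

sum-3+ : ∀ x b → 3 + x + (3 + b) ≡ 6 + (x + b)
sum-3+ = solve-∀

Gap-3+⇒Gap : ∀ x b → Gap (3 + x) (3 + b) → Gap x b
Gap-3+⇒Gap x b (s≤s (s≤s (s≤s x+2≤b)) , inj₁ 3∣sum) =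
  x+2≤b , inj₁ (∣m+n∣m⇒∣n (subst (3 ∣_) (sum-3+ x b) 3∣sum) (divides 2 refl))
Gap-3+⇒Gap x b (s≤s (s≤s (s≤s x+2≤b)) , inj₂ (s≤s (s≤s (s≤s x+4≤b)))) = x+2≤b , inj₂ x+4≤b

Gap⇒Gap-3+ : ∀ x b → Gap x b → Gap (3 + x) (3 + b)
Gap⇒Gap-3+ x b (x+2≤b , inj₁ 3∣sum) =
  s≤s (s≤s (s≤s x+2≤b)) , inj₁ (subst (3 ∣_) (sym (sum-3+ x b)) (∣m∣n⇒∣m+n (divides 2 refl) 3∣sum))
Gap⇒Gap-3+ x b (x+2≤b , inj₂ x+4≤b) = s≤s (s≤s (s≤s x+2≤b)) , inj₂ (s≤s (s≤s (s≤s x+4≤b)))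

-- Lowering each of the m + 1 parts by 3 lowers the weight by 3 (m + 1).
conv-After-3+ : ∀ m (c c' : ℕ → ℕ) → (∀ b → b < 3 → c b ≡ 0) → (∀ b → c (3 + b) ≡ c' b) →
                (∀ b → AgreeAt m (After (3 + b)) (dilate (After b))) →
                conv (λ b k → c b * After b k m) ≗ shift (3 * suc m) (conv (λ b k → c' b * After b k m))
conv-After-3+ m c c' small c≡c' After≡ n = begin
  conv (λ b k → c b * After b k m) n
    ≡⟨ conv-offset 3 (λ b k → c b * After b k m) (λ b b<3 k → cong (_* After b k m) (small b b<3)) n ⟩
  shift 3 (conv (λ b k → c (3 + b) * After (3 + b) k m)) n
    ≡⟨ shift-congʳ 3 (conv-cong (λ b k → cong₂ _*_ (c≡c' b) (coeff (After≡ b) k))) n ⟩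
  shift 3 (conv (λ b k → c' b * shift (3 * m) (λ j → After b j m) k)) n
    ≡⟨ shift-congʳ 3 (conv-cong (λ b → *-shift (c' b) (3 * m) (λ j → After b j m))) n ⟩
  shift 3 (conv (λ b → shift (3 * m) (λ k → c' b * After b k m))) n
    ≡⟨ shift-congʳ 3 (conv-shift (3 * m) (λ b k → c' b * After b k m)) n ⟩
  shift 3 (shift (3 * m) (conv (λ b k → c' b * After b k m))) n
    ≡⟨ shift-+ 3 (3 * m) (conv (λ b k → c' b * After b k m)) n ⟩
  shift (3 + 3 * m) (conv (λ b k → c' b * After b k m)) n
    ≡⟨ shift-congˡ (conv (λ b k → c' b * After b k m)) (*-suc 3 m) n ⟨
  shift (3 * suc m) (conv (λ b k → c' b * After b k m)) n
    ∎
  where open ≡-Reasoning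

After-3+ : ∀ x → After (3 + x) ≈ dilate (After x)
After-3+ x n zero = refl
After-3+ x n (suc m) =
  conv-After-3+ m (λ b → indicator (gap? (3 + x) b)) (λ b → indicator (gap? x b))
    (λ b b<3 → indicator-no (gap? (3 + x) b) (λ gap → <⇒≱ b<3 (≤-trans (m≤m+n 3 (x + 2)) (proj₁ gap))))
    (λ b → indicator-⇔ (Gap-3+⇒Gap x b) (Gap⇒Gap-3+ x b) (gap? (3 + x) (3 + b)) (gap? x b))
    (λ b → agreeAt (λ k → After-3+ b k m)) n

From-3+ : ∀ a → From (3 + a) ≈ dilate (From a)
From-3+ a n zero = refl
From-3+ a n (suc m) =
  conv-After-3+ m (λ b → indicator (3 + a ≤? b)) (λ b → indicator (a ≤? b))
    (λ b b<3 → indicator-no (3 + a ≤? b) (λ 3+a≤b → <⇒≱ b<3 (≤-trans (m≤m+n 3 a) 3+a≤b)))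
    (λ b → indicator-⇔ (λ { (s≤s (s≤s (s≤s a≤b))) → a≤b }) (λ a≤b → s≤s (s≤s (s≤s a≤b)))
                       (3 + a ≤? 3 + b) (a ≤? b))
    (λ b → agreeAt (λ k → After-3+ b k m)) n

From-eq₁ : From 1 ≈ x^ 1 q^ 1 · dilate (From 2) ⊞ From 2
From-eq₁ = begin
  From 1
    ≈⟨ From-split 1 ⟩
  x^ 1 q^ 1 · After 1 ⊞ From 2
    ≈⟨ ⊞-cong (mon-cong 1 1 (≈-trans (After≈From 1 5 gap-1) (From-3+ 2))) ≈-refl ⟩
  x^ 1 q^ 1 · dilate (From 2) ⊞ From 2
    ∎
  where open ≈-Reasoning

From-eq₂ : From 2 ≈ x^ 2 q^ 6 · dilate (dilate (From 2)) ⊞ x^ 1 q^ 2 · dilate (From 3) ⊞ From 3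
From-eq₂ = begin
  From 2
    ≈⟨ From-split 2 ⟩
  x^ 1 q^ 2 · After 2 ⊞ From 3
    ≈⟨ ⊞-cong (mon-cong 1 2 After-2) ≈-refl ⟩
  x^ 1 q^ 2 · (x^ 1 q^ 4 · After 4 ⊞ From 6) ⊞ From 3
    ≈⟨ ⊞-cong (≈-trans (mon-⊞ 1 2 (x^ 1 q^ 4 · After 4) (From 6))
                       (⊞-cong (mon-mon 1 2 1 4 (After 4)) ≈-refl))
              ≈-refl ⟩
  x^ 2 q^ 6 · After 4 ⊞ x^ 1 q^ 2 · From 6 ⊞ From 3
    ≈⟨ ⊞-cong (⊞-cong (mon-cong 2 6 (≈-trans (After≈From 4 8 gap-4) (≈-trans (From-3+ 5) (dilate-cong (From-3+ 2)))))
                      (mon-cong 1 2 (From-3+ 3)))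
              ≈-refl ⟩
  x^ 2 q^ 6 · dilate (dilate (From 2)) ⊞ x^ 1 q^ 2 · dilate (From 3) ⊞ From 3
    ∎
  where open ≈-Reasoning

From-eq₃ : From 3 ≈ x^ 1 q^ 3 · dilate (From 3) ⊞ dilate (From 1)
From-eq₃ = begin
  From 3
    ≈⟨ From-split 3 ⟩
  x^ 1 q^ 3 · After 3 ⊞ From 4
    ≈⟨ ⊞-cong (mon-cong 1 3 (≈-trans (After≈From 3 6 gap-3) (From-3+ 3))) (From-3+ 1) ⟩
  x^ 1 q^ 3 · dilate (From 3) ⊞ dilate (From 1)
    ∎
  where open ≈-Reasoning

From-system : System (From 1) (From 2) (From 3)
From-system = record
  { eq₁ = From-eq₁ ; eq₂ = From-eq₂ ; eq₃ = From-eq₃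
  ; const₁ = λ _ → refl ; const₂ = λ _ → refl ; const₃ = λ _ → refl
  }

-- Counting the candidate lists of cp0

count : ∀ {A : Set} {P : A → Set} → Decidable P → List A → ℕ
count P? xs = length (filter P? xs)

module _ {A : Set} where

  count-∷ : ∀ {P : A → Set} (P? : Decidable P) x xs → count P? (x ∷ xs) ≡ indicator (P? x) + count P? xs
  count-∷ P? x xs with does (P? x)
  ... | true = refl
  ... | false = refl

  count-++ : ∀ {P : A → Set} (P? : Decidable P) xs ys → count P? (xs ++ ys) ≡ count P? xs + count P? ys
  count-++ P? xs ys = trans (cong length (filter-++ P? xs ys)) (length-++ (filter P? xs))

  count-concatMap : ∀ {P : A → Set} (P? : Decidable P) (f : ℕ → List A) bs →
                    count P? (concatMap f bs) ≡ sum (map (λ b → count P? (f b)) bs)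
  count-concatMap P? f [] = refl
  count-concatMap P? f (b ∷ bs) =
    trans (count-++ P? (f b) (concatMap f bs)) (cong (count P? (f b) +_) (count-concatMap P? f bs))

  count-cong : ∀ {P Q : A → Set} (P? : Decidable P) (Q? : Decidable Q) → (∀ x → P x → Q x) → (∀ x → Q x → P x) →
               ∀ xs → count P? xs ≡ count Q? xs
  count-cong P? Q? P⇒Q Q⇒P [] = refl
  count-cong P? Q? P⇒Q Q⇒P (x ∷ xs) =
    trans (count-∷ P? x xs)
          (trans (cong₂ _+_ (indicator-⇔ (P⇒Q x) (Q⇒P x) (P? x) (Q? x)) (count-cong P? Q? P⇒Q Q⇒P xs))
                 (sym (count-∷ Q? x xs)))

  count-×-const : ∀ {B : Set} {Q : A → Set} (d : Dec B) (Q? : Decidable Q) xs →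
                  count (λ x → d ×-dec Q? x) xs ≡ indicator d * count Q? xs
  count-×-const d Q? [] = sym (*-zeroʳ (indicator d))
  count-×-const d Q? (x ∷ xs) = begin
    count (λ x → d ×-dec Q? x) (x ∷ xs)                      ≡⟨ count-∷ (λ x → d ×-dec Q? x) x xs ⟩
    indicator (d ×-dec Q? x) + count (λ x → d ×-dec Q? x) xs ≡⟨ cong₂ _+_ (indicator-× d (Q? x)) (count-×-const d Q? xs) ⟩
    indicator d * indicator (Q? x) + indicator d * count Q? xs ≡⟨ *-distribˡ-+ (indicator d) _ _ ⟨
    indicator d * (indicator (Q? x) + count Q? xs)           ≡⟨ cong (indicator d *_) (count-∷ Q? x xs) ⟨
    indicator d * count Q? (x ∷ xs)                          ∎
    where open ≡-Reasoning

count-map-∷ : ∀ {P : List ℕ → Set} (P? : Decidable P) b xs → count P? (map (b ∷_) xs) ≡ count (λ l → P? (b ∷ l)) xs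
count-map-∷ P? b [] = refl
count-map-∷ P? b (l ∷ xs) =
  trans (count-∷ P? (b ∷ l) (map (b ∷_) xs))
        (trans (cong (indicator (P? (b ∷ l)) +_) (count-map-∷ P? b xs)) (sym (count-∷ (λ l → P? (b ∷ l)) l xs)))

sum-map-range1 : ∀ (g : ℕ → ℕ) B → g 0 ≡ 0 → sum (map g (range1 B)) ≡ Σ≤ B g
sum-map-range1 g zero g0≡0 = sym g0≡0
sum-map-range1 g (suc B) g0≡0 = begin
  sum (map g (range1 B ++ suc B ∷ []))           ≡⟨ cong sum (map-++ g (range1 B) (suc B ∷ [])) ⟩
  sum (map g (range1 B) ++ g (suc B) ∷ [])       ≡⟨ sum-++ (map g (range1 B)) (g (suc B) ∷ []) ⟩
  sum (map g (range1 B)) + (g (suc B) + 0)       ≡⟨ cong₂ _+_ (sum-map-range1 g B g0≡0) (+-identityʳ (g (suc B))) ⟩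
  Σ≤ B g + g (suc B)                             ∎
  where open ≡-Reasoning

Chain : (ℕ → Set) → List ℕ → Set
Chain p [] = ⊤
Chain p (b ∷ l) = p b × Chain (Gap b) l

chain? : ∀ {p : ℕ → Set} → Decidable p → Decidable (Chain p)
chain? p? [] = yes tt
chain? p? (b ∷ l) = p? b ×-dec chain? (gap? b) l

Admissible : (ℕ → Set) → ℕ → ℕ → List ℕ → Set
Admissible p n m l = length l ≡ m × sum l ≡ n × Chain p l

admissible? : ∀ {p : ℕ → Set} → Decidable p → ∀ n m → Decidable (Admissible p n m)
admissible? p? n m l = (length l ≟ m) ×-dec ((sum l ≟ n) ×-dec chain? p? l)

module _ {p : ℕ → Set} (p? : Decidable p) where

  count-admissible-zero : ∀ n B → count (admissible? p? n 0) (lists 0 B) ≡ one n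
  count-admissible-zero zero B = cong (_+ 0) (indicator-yes (admissible? p? 0 0 []) (refl , refl , tt))
  count-admissible-zero (suc n) B = cong (_+ 0) (indicator-no (admissible? p? (suc n) 0 []) (λ { (_ , () , _) }))

  count-admissible-suc : ∀ m n B → n ≤ B → ¬ p 0 →
    count (admissible? p? n (suc m)) (lists (suc m) B)
      ≡ conv (λ b k → indicator (p? b) * count (admissible? (gap? b) k m) (lists m B)) n
  count-admissible-suc m n B n≤B ¬p0 = begin
    count (admissible? p? n (suc m)) (lists (suc m) B)
      ≡⟨ count-concatMap (admissible? p? n (suc m)) (λ b → map (b ∷_) (lists m B)) (range1 B) ⟩
    sum (map (λ b → count (admissible? p? n (suc m)) (map (b ∷_) (lists m B))) (range1 B))
      ≡⟨ cong sum (map-cong (λ b → first-part b) (range1 B)) ⟩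
    sum (map first (range1 B))
      ≡⟨ sum-map-range1 first B (cong (λ d → d * indicator (0 ≤? n) * C 0) (indicator-no (p? 0) ¬p0)) ⟩
    Σ≤ B first
      ≡⟨ Σ≤-truncate B n n≤B (λ b n<b _ → trans (cong (λ d → indicator (p? b) * d * C b) (indicator-no (b ≤? n) (<⇒≱ n<b)))
                                                 (cong (_* C b) (*-zeroʳ (indicator (p? b))))) ⟩
    Σ≤ n first
      ≡⟨ Σ≤-cong n (λ b b≤n → trans (cong (λ d → indicator (p? b) * d * C b) (indicator-yes (b ≤? n) b≤n))
                                      (cong (_* C b) (*-identityʳ (indicator (p? b))))) ⟩
    conv (λ b k → indicator (p? b) * count (admissible? (gap? b) k m) (lists m B)) n
      ∎
    where
    open ≡-Reasoning
    C : ℕ → ℕ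
    C b = count (admissible? (gap? b) (n ∸ b) m) (lists m B)
    first : ℕ → ℕ
    first b = indicator (p? b) * indicator (b ≤? n) * C b
    to : ∀ b l → Admissible p n (suc m) (b ∷ l) → (p b × b ≤ n) × Admissible (Gap b) (n ∸ b) m l
    to b l (length≡ , sum≡ , pb , chain) =
      (pb , subst (b ≤_) sum≡ (m≤m+n b (sum l))) , suc-injective length≡ ,
      trans (sym (m+n∸m≡n b (sum l))) (cong (_∸ b) sum≡) , chain
    from : ∀ b l → (p b × b ≤ n) × Admissible (Gap b) (n ∸ b) m l → Admissible p n (suc m) (b ∷ l)
    from b l ((pb , b≤n) , length≡ , sum≡ , chain) =
      cong suc length≡ , trans (cong (b +_) sum≡) (m+[n∸m]≡n b≤n) , pb , chain
    first-part : ∀ b → count (admissible? p? n (suc m)) (map (b ∷_) (lists m B)) ≡ first b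
    first-part b =
      trans (count-map-∷ (admissible? p? n (suc m)) b (lists m B))
      (trans (count-cong _ (λ l → (p? b ×-dec (b ≤? n)) ×-dec admissible? (gap? b) (n ∸ b) m l) (to b) (from b) (lists m B))
      (trans (count-×-const (p? b ×-dec (b ≤? n)) (admissible? (gap? b) (n ∸ b) m) (lists m B))
             (cong (_* C b) (indicator-× (p? b) (b ≤? n)))))

count-After : ∀ m x n B → n ≤ B → count (admissible? (gap? x) n m) (lists m B) ≡ After x n m
count-After zero x n B n≤B = count-admissible-zero (gap? x) n B
count-After (suc m) x n B n≤B =
  trans (count-admissible-suc (gap? x) m n B n≤B (λ gap → 2+x≰0 (proj₁ gap)))
        (Σ≤-cong n (λ b _ → cong (indicator (gap? x b) *_) (count-After m b (n ∸ b) B (≤-trans (m∸n≤m n b) n≤B))))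
  where
  2+x≰0 : ¬ x + 2 ≤ 0
  2+x≰0 x+2≤0 = <⇒≱ (m≤n+m 2 x) (≤-trans x+2≤0 z≤n)

Chain-Gap⇒GapsOK : ∀ b l → Chain (Gap b) l → GapsOK (b ∷ l)
Chain-Gap⇒GapsOK b [] _ = tt
Chain-Gap⇒GapsOK b (c ∷ l) (gap , chain) = gap , Chain-Gap⇒GapsOK c l chain

GapsOK⇒Chain-Gap : ∀ b l → GapsOK (b ∷ l) → Chain (Gap b) l
GapsOK⇒Chain-Gap b [] _ = tt
GapsOK⇒Chain-Gap b (c ∷ l) (gap , gaps) = gap , GapsOK⇒Chain-Gap c l gaps

Chain-Gap⇒NonDecr : ∀ b l → Chain (Gap b) l → NonDecr (b ∷ l)
Chain-Gap⇒NonDecr b [] _ = tt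
Chain-Gap⇒NonDecr b (c ∷ l) (gap , chain) = ≤-trans (m≤m+n b 2) (proj₁ gap) , Chain-Gap⇒NonDecr c l chain

Chain-Gap⇒positive : ∀ b l → 1 ≤ b → Chain (Gap b) l → All (1 ≤_) (b ∷ l)
Chain-Gap⇒positive b [] 1≤b _ = 1≤b ∷ []
Chain-Gap⇒positive b (c ∷ l) 1≤b (gap , chain) =
  1≤b ∷ Chain-Gap⇒positive c l (≤-trans 1≤b (≤-trans (m≤m+n b 2) (proj₁ gap))) chain

IsCP0⇒Admissible : ∀ n m l → IsCP0 n m l → Admissible (1 ≤_) n m l
IsCP0⇒Admissible n m [] (length≡ , sum≡ , _) = length≡ , sum≡ , tt
IsCP0⇒Admissible n m (b ∷ l) (length≡ , sum≡ , (1≤b ∷ _) , _ , gaps) =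
  length≡ , sum≡ , 1≤b , GapsOK⇒Chain-Gap b l gaps

Admissible⇒IsCP0 : ∀ n m l → Admissible (1 ≤_) n m l → IsCP0 n m l
Admissible⇒IsCP0 n m [] (length≡ , sum≡ , _) = length≡ , sum≡ , [] , tt , tt
Admissible⇒IsCP0 n m (b ∷ l) (length≡ , sum≡ , 1≤b , chain) =
  length≡ , sum≡ , Chain-Gap⇒positive b l 1≤b chain , Chain-Gap⇒NonDecr b l chain , Chain-Gap⇒GapsOK b l chain

cp0≡From1 : ∀ n m → cp0 n m ≡ From 1 n m
cp0≡From1 n m =
  trans (count-cong (isCP0? n m) (admissible? (1 ≤?_) n m) (IsCP0⇒Admissible n m) (Admissible⇒IsCP0 n m) (lists m n))
        (counted m)
  where
  counted : ∀ m → count (admissible? (1 ≤?_) n m) (lists m n) ≡ From 1 n m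
  counted zero = count-admissible-zero (1 ≤?_) n n
  counted (suc m) =
    trans (count-admissible-suc (1 ≤?_) m n n ≤-refl (λ ()))
          (Σ≤-cong n (λ b _ → cong (indicator (1 ≤? b) *_) (count-After m b (n ∸ b) n (m∸n≤m n b))))

theorem10 : (n m : ℕ) → cp0 n m ≡ rhsCoeff n m
theorem10 n m = begin
  cp0 n m      ≡⟨ cp0≡From1 n m ⟩
  From 1 n m   ≡⟨ system-unique From-system R-system n m ⟩
  R₁ n m       ≡⟨ rhsCoeff≡R₁ n m ⟨
  rhsCoeff n m ∎
  where open ≡-Reasoning
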